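{- Let $P=(X,\prec)$ be a finite poset of width two with $n=|X|$ elements and a fixed partition into chains $\mathcal{C}_1=\{\alpha_1\prec\cdots\prec\alpha_{a}\}$, $\mathcal{C}_2=\{\beta_1\prec\cdots\prec\beta_{b}\}$. Let $x=\alpha_s$ and $y=\alpha_{s+r}$ with $r\ge1$. Let $F(j)$ be the number of linear extensions $L$ of $P$ with $L(y)-L(x)=j$, and suppose $k\in\{2,\dots,n-2\}$ and $F(k)>0$. Then $(x,y)$ satisfies the $k$-midway property if and only if there are integers $1<c<d\le n$ such that: $\alpha_{s-1}\prec\beta_{c-s}\prec\cdots\prec\beta_{d-s}\prec\alpha_{s+1}$; $\beta_{c+k-r-s}\prec\alpha_{s+r}\prec\beta_{d+k-r-s}$; $\alpha_s\,\|\,\beta_{j}$ for all $c-s\le j\le d-s$; and $\alpha_{s+r}\,\|\,\beta_{j}$ for all $c+(k-r-s)+1\le j\le d+(k-r-s)-1$.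
   Context: A linear extension of $P$ is a bijection $L:X\to\{1,\dots,n\}$ with $L(u)<L(v)$ whenever $u\prec v$; $u\,\|\,v$ means incomparable. For $u\in X$ let $f(u):=|\{v:v\prec u\}|$, $g(u):=|\{v:v\succ u\}|$, and for $u,w\in X$ let $h(u,w):=|\{v:u\prec v\prec w\}|$. The pair $(x,y)$ satisfies the $k$-midway property if: $f(z)+g(y)>n-k$ for every $z\in X$ with $x\prec z$ and $z\not\succ y$; $h(z,y)>k$ for every $z\prec x$; and $f(y)>k$. -}

module Defs where

open import Level using (0ℓ)
open import Data.Nat as ℕ using (ℕ; zero; suc; _+_; _∸_)
open import Data.Fin as Fin using (Fin; toℕ; fromℕ<)
open import Data.Sum using (_⊎_; inj₁; inj₂)
open import Data.List using (List; length; filter; map; _++_; allFin)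
open import Data.Integer as ℤ using (ℤ; +_; -[1+_])
open import Data.Product using (_×_; Σ; ∃; _,_)
open import Data.Empty using (⊥)
open import Data.Unit using (⊤)
open import Relation.Binary using (Rel; Decidable)
open import Relation.Nullary using (¬_; yes; no)
open import Relation.Binary.PropositionalEquality using (_≡_)
open import Function.Definitions using (Bijective)

-- Ground set X of a width-two poset with a fixed chain partition
-- C₁ = {α_1 ≺ ... ≺ α_a}, C₂ = {β_1 ≺ ... ≺ β_b}:
-- α_i is  inj₁ (i-1)  and  β_j is  inj₂ (j-1)  (1-based paper indices).
Elt : ℕ → ℕ → Set
Elt a b = Fin a ⊎ Fin b

allElt : (a b : ℕ) → List (Elt a b)
allElt a b = map inj₁ (allFin a) ++ map inj₂ (allFin b)

-- Elements extended by a bottom \hat0 and a top \hat1, used for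
-- out-of-range chain indices (α_i = \hat0 for i ≤ 0, \hat1 for i > a).
data Ext (X : Set) : Set where
  bot : Ext X
  el  : X → Ext X
  top : Ext X

module WidthTwo {a b : ℕ} (_≺_ : Rel (Elt a b) 0ℓ) (_≺?_ : Decidable _≺_) where

  n : ℕ
  n = a + b

  f : Elt a b → ℕ
  f u = length (filter (λ v → v ≺? u) (allElt a b))

  g : Elt a b → ℕ
  g u = length (filter (λ v → u ≺? v) (allElt a b))

  h : Elt a b → Elt a b → ℕ
  h u w = length (filter (λ v → u ≺? v) (filter (λ v → v ≺? w) (allElt a b)))

  -- linear extension: bijection L : X → {1..n} (here Fin n, shifted by one)
  -- with L(u) < L(v) whenever u ≺ v
  IsLinExt : (Elt a b → Fin n) → Set
  IsLinExt L = Bijective _≡_ _≡_ L × (∀ {u v} → u ≺ v → toℕ (L u) ℕ.< toℕ (L v))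

  Midway : Elt a b → Elt a b → ℕ → Set
  Midway x y k =
      (∀ z → x ≺ z → ¬ (y ≺ z) → n ∸ k ℕ.< f z + g y)
    × (∀ z → z ≺ x → k ℕ.< h z y)
    × (k ℕ.< f y)

  _⊏_ : Ext (Elt a b) → Ext (Elt a b) → Set
  bot  ⊏ bot  = ⊥
  bot  ⊏ el _ = ⊤
  bot  ⊏ top  = ⊤
  el _ ⊏ bot  = ⊥
  el u ⊏ el v = u ≺ v
  el _ ⊏ top  = ⊤
  top  ⊏ _    = ⊥

  _∥_ : Ext (Elt a b) → Ext (Elt a b) → Set
  p ∥ q = ¬ (p ⊏ q) × ¬ (q ⊏ p)

  α : ℤ → Ext (Elt a b)
  α -[1+ _ ]    = bot
  α (+ zero)    = bot
  α (+ suc m) with m ℕ.<? a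
  ... | yes p = el (inj₁ (fromℕ< p))
  ... | no  _ = top

  β : ℤ → Ext (Elt a b)
  β -[1+ _ ]    = bot
  β (+ zero)    = bot
  β (+ suc m) with m ℕ.<? b
  ... | yes p = el (inj₂ (fromℕ< p))
  ... | no  _ = top

  Conditions : (s r k c d : ℤ) → Set
  Conditions s r k c d =
      ( (α (s ℤ.- + 1) ⊏ β (c ℤ.- s))
      × (∀ j → c ℤ.- s ℤ.≤ j → j ℤ.< d ℤ.- s → β j ⊏ β (j ℤ.+ + 1))
      × (β (d ℤ.- s) ⊏ α (s ℤ.+ + 1)) )
    × ( (β (c ℤ.+ k ℤ.- r ℤ.- s) ⊏ α (s ℤ.+ r))
      × (α (s ℤ.+ r) ⊏ β (d ℤ.+ k ℤ.- r ℤ.- s)) )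
    × (∀ j → c ℤ.- s ℤ.≤ j → j ℤ.≤ d ℤ.- s → α s ∥ β j)
    × (∀ j → c ℤ.+ (k ℤ.- r ℤ.- s) ℤ.+ + 1 ℤ.≤ j
           → j ℤ.≤ d ℤ.+ (k ℤ.- r ℤ.- s) ℤ.- + 1 → α (s ℤ.+ r) ∥ β j)

-- Everything is governed by cut points on the chain β: ℓ and u (resp. ℓx and ux) delimit the
-- β-elements below and above y (resp. x), and ℓ⁺ the β-elements below α_{s+1}. Since both
-- chains are totally ordered, f, g and h at chain elements are sums of two interval lengths,
-- and the extreme witnesses (α_{s+1} and the first β above x in the first clause, α_{s-1} and
-- the last β below x in the second) turn each clause of the midway property into a linear
-- inequality between these cut points. Writing k = r + e, the inequalities say precisely that
-- c = s + ℓ − e and d = s + 1 + u − e satisfy the four conditions, and conversely any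
-- admissible (c, d) forces them.

module Submission where

open import Defs
open import Level using (0ℓ)
open import Data.Nat as ℕ using (ℕ; zero; suc; _+_; _∸_; _≤_; _<_; z≤n; s≤s; s≤s⁻¹; z<s; _≤?_; _<?_)
open import Data.Nat.Properties
open import Data.Nat.Tactic.RingSolver using (solve-∀)
open import Data.Fin as Fin using (Fin; toℕ; fromℕ<)
open import Data.Fin.Properties using (toℕ-injective; toℕ-fromℕ<; toℕ<n)
open import Data.Sum using (_⊎_; inj₁; inj₂)
open import Data.Integer as ℤ using (ℤ; +_)
open import Data.Integer.Properties using (drop‿+≤+; drop‿+<+)
import Data.Integer.Tactic.RingSolver as ℤ-Solver
open import Data.List using (List; []; _∷_; length; filter; map; _++_; allFin)
open import Data.List.Properties using (length-++; filter-++; map-tabulate)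
open import Data.Product using (_×_; Σ; _,_; proj₁; proj₂)
open import Data.Empty using (⊥-elim)
open import Data.Unit using (tt)
open import Relation.Binary using (Rel; Decidable; IsStrictPartialOrder; tri<; tri≈; tri>)
open import Relation.Binary.PropositionalEquality
  using (_≡_; refl; sym; trans; cong; cong₂; subst; subst₂; module ≡-Reasoning)
open import Relation.Nullary using (¬_; yes; no)
open import Relation.Nullary.Decidable using (_×-dec_; ¬?; decidable-stable)
open import Relation.Unary using (Pred) renaming (Decidable to Decidable₁)
open import Function.Base using (id)
open import Function.Bundles using (_⇔_; mk⇔; Equivalence)
open import Function.Properties.Equivalence using () renaming (trans to ⇔-trans)

count : {A : Set} {P : Pred A 0ℓ} → Decidable₁ P → List A → ℕ
count P? xs = length (filter P? xs)

module _ {A : Set} {P Q : Pred A 0ℓ} (P? : Decidable₁ P) (Q? : Decidable₁ Q) where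

  count-mono : (∀ v → P v → Q v) → ∀ xs → count P? xs ≤ count Q? xs
  count-mono P⇒Q [] = z≤n
  count-mono P⇒Q (v ∷ xs) with P? v | Q? v
  ... | yes _  | yes _  = s≤s (count-mono P⇒Q xs)
  ... | yes Pv | no ¬Qv = ⊥-elim (¬Qv (P⇒Q v Pv))
  ... | no _   | yes _  = m≤n⇒m≤1+n (count-mono P⇒Q xs)
  ... | no _   | no _   = count-mono P⇒Q xs

  count-filter : ∀ xs → count P? (filter Q? xs) ≡ count (λ v → P? v ×-dec Q? v) xs
  count-filter [] = refl
  count-filter (v ∷ xs) with Q? v
  count-filter (v ∷ xs) | yes _ with P? v
  ... | yes _ = cong suc (count-filter xs)
  ... | no _  = count-filter xs
  count-filter (v ∷ xs) | no _ with P? v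
  ... | yes _ = count-filter xs
  ... | no _  = count-filter xs

count-++ : {A : Set} {P : Pred A 0ℓ} (P? : Decidable₁ P) (xs ys : List A) →
           count P? (xs ++ ys) ≡ count P? xs + count P? ys
count-++ P? xs ys = trans (cong length (filter-++ P? xs ys)) (length-++ (filter P? xs))

count-map : {A B : Set} {P : Pred B 0ℓ} (P? : Decidable₁ P) (f : A → B) (xs : List A) →
            count P? (map f xs) ≡ count (λ v → P? (f v)) xs
count-map P? f [] = refl
count-map P? f (x ∷ xs) with P? (f x)
... | yes _ = cong suc (count-map P? f xs)
... | no _  = count-map P? f xs

count-interval : ∀ N {P : Pred (Fin N) 0ℓ} (P? : Decidable₁ P) lo hi → hi ≤ N →
                 (∀ p → P p ⇔ (lo ≤ toℕ p × toℕ p < hi)) → count P? (allFin N) ≡ hi ∸ lo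
count-interval zero P? lo zero z≤n _ = sym (0∸n≡0 lo)
count-interval (suc N) {P} P? lo hi hi≤ P⇔ = trans (cong (count P?) allFin-suc) (step lo hi hi≤ P⇔)
  where
  allFin-suc : allFin (suc N) ≡ Fin.zero ∷ map Fin.suc (allFin N)
  allFin-suc = cong (Fin.zero ∷_) (sym (map-tabulate id Fin.suc))
  rest : ∀ lo hi → hi ≤ N → (∀ p → P (Fin.suc p) ⇔ (lo ≤ toℕ p × toℕ p < hi)) →
         count P? (map Fin.suc (allFin N)) ≡ hi ∸ lo
  rest lo hi hi≤ P⇔′ = trans (count-map P? Fin.suc (allFin N))
                             (count-interval N (λ p → P? (Fin.suc p)) lo hi hi≤ P⇔′)
  step : ∀ lo hi → hi ≤ suc N → (∀ p → P p ⇔ (lo ≤ toℕ p × toℕ p < hi)) →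
         count P? (Fin.zero ∷ map Fin.suc (allFin N)) ≡ hi ∸ lo
  step lo zero _ P⇔ with P? Fin.zero
  ... | yes P0 = ⊥-elim (n≮0 (proj₂ (Equivalence.to (P⇔ _) P0)))
  ... | no _ = trans (rest 0 0 z≤n λ p → mk⇔ (λ Pp → ⊥-elim (n≮0 (proj₂ (Equivalence.to (P⇔ _) Pp)))) λ ())
                     (sym (0∸n≡0 lo))
  step zero (suc hi) (s≤s hi≤) P⇔ with P? Fin.zero
  ... | yes _ = cong suc (rest 0 hi hi≤ λ p → mk⇔ (λ Pp → z≤n , s≤s⁻¹ (proj₂ (Equivalence.to (P⇔ _) Pp)))
                                                  (λ (_ , lt) → Equivalence.from (P⇔ _) (z≤n , s≤s lt)))
  ... | no ¬P0 = ⊥-elim (¬P0 (Equivalence.from (P⇔ _) (z≤n , s≤s z≤n)))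
  step (suc lo) (suc hi) (s≤s hi≤) P⇔ with P? Fin.zero
  ... | yes P0 = ⊥-elim (n≮0 (proj₁ (Equivalence.to (P⇔ _) P0)))
  ... | no _ = rest lo hi hi≤ λ p → mk⇔ (λ Pp → let (l , h) = Equivalence.to (P⇔ _) Pp in s≤s⁻¹ l , s≤s⁻¹ h)
                                        (λ (l , h) → Equivalence.from (P⇔ _) (s≤s l , s≤s h))

record InitialSegment {N : ℕ} (P : Pred (Fin N) 0ℓ) : Set where
  field
    end      : ℕ
    end≤     : end ≤ N
    member⇒< : ∀ q → P q → toℕ q < end
    <⇒member : ∀ q → toℕ q < end → P q

record FinalSegment {N : ℕ} (P : Pred (Fin N) 0ℓ) : Set where
  field
    start    : ℕ
    start≤   : start ≤ N
    member⇒≥ : ∀ q → P q → start ≤ toℕ q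
    ≥⇒member : ∀ q → start ≤ toℕ q → P q

initialSegment : ∀ {N} {P : Pred (Fin N) 0ℓ} → Decidable₁ P →
                 (∀ p q → toℕ p < toℕ q → P q → P p) → InitialSegment P
initialSegment {zero} P? closed = record { end = 0 ; end≤ = z≤n ; member⇒< = λ () ; <⇒member = λ () }
initialSegment {suc N} {P} P? closed with P? Fin.zero
... | no ¬P0 = record
  { end = 0 ; end≤ = z≤n ; <⇒member = λ _ ()
  ; member⇒< = λ { Fin.zero P0 → ⊥-elim (¬P0 P0)
                 ; (Fin.suc q) Pq → ⊥-elim (¬P0 (closed Fin.zero (Fin.suc q) (s≤s z≤n) Pq)) }
  }
... | yes P0 = record
  { end = suc end ; end≤ = s≤s end≤
  ; member⇒< = λ { Fin.zero _ → s≤s z≤n ; (Fin.suc q) Pq → s≤s (member⇒< q Pq) }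
  ; <⇒member = λ { Fin.zero _ → P0 ; (Fin.suc q) lt → <⇒member q (s≤s⁻¹ lt) }
  }
  where
  open InitialSegment (initialSegment (λ q → P? (Fin.suc q)) (λ p q lt → closed (Fin.suc p) (Fin.suc q) (s≤s lt)))

finalSegment : ∀ {N} {P : Pred (Fin N) 0ℓ} → Decidable₁ P →
               (∀ p q → toℕ p < toℕ q → P p → P q) → FinalSegment P
finalSegment {P = P} P? closed = record
  { start = end ; start≤ = end≤
  ; member⇒≥ = λ q Pq → ≮⇒≥ λ lt → <⇒member q lt Pq
  ; ≥⇒member = λ q le → decidable-stable (P? q) λ ¬Pq → <⇒≱ (member⇒< q ¬Pq) le
  }
  where
  open InitialSegment (initialSegment (λ q → ¬? (P? q)) (λ p q lt ¬Pq Pp → ¬Pq (closed p q lt Pp)))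

zero⊎suc : ∀ m → m ≡ 0 ⊎ Σ ℕ λ m′ → m ≡ suc m′
zero⊎suc zero = inj₁ refl
zero⊎suc (suc m′) = inj₂ (m′ , refl)

<-transpose : ∀ {m n o p} → m + p ≡ o + n → (m < n) ⇔ (o < p)
<-transpose {m} {n} {o} {p} eq = mk⇔ (shift eq) (shift (sym eq))
  where
  shift : ∀ {m n o p} → m + p ≡ o + n → m < n → o < p
  shift {m} {n} {o} {p} eq m<n =
    +-cancelʳ-< n o p (subst₂ _<_ eq (+-comm n p) (+-monoˡ-< p m<n))

∸<⇔<+ : ∀ {m n o} → n ≤ m → (m ∸ n < o) ⇔ (m < o + n)
∸<⇔<+ {m} {n} {o} n≤m = mk⇔
  (λ lt → subst (_< o + n) (m∸n+n≡m n≤m) (+-monoˡ-< n lt))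
  (λ lt → subst (_≤ o) (+-∸-assoc 1 n≤m) (subst (suc m ∸ n ≤_) (m+n∸n≡m o n) (∸-monoˡ-≤ n lt)))

module ChainPartition
  (a b : ℕ) (_≺_ : Rel (Elt a b) 0ℓ) (_≺?_ : Decidable _≺_)
  (spo : IsStrictPartialOrder _≡_ _≺_)
  (α-chain : ∀ (p q : Fin a) → p Fin.< q → inj₁ p ≺ inj₁ q)
  (β-chain : ∀ (p q : Fin b) → p Fin.< q → inj₂ p ≺ inj₂ q)
  where

  open WidthTwo _≺_ _≺?_
  open IsStrictPartialOrder spo using (irrefl; asym) renaming (trans to ≺-trans)

  module Chain {N : ℕ} (ι : Fin N → Elt a b) (chain : ∀ p q → p Fin.< q → ι p ≺ ι q) where

    reflects : ∀ {p q} → ι p ≺ ι q → toℕ p < toℕ q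
    reflects {p} {q} ιp≺ιq with <-cmp (toℕ p) (toℕ q)
    ... | tri< lt _ _ = lt
    ... | tri≈ _ eq _ = ⊥-elim (irrefl refl (subst (λ t → ι p ≺ ι t) (sym (toℕ-injective eq)) ιp≺ιq))
    ... | tri> _ _ gt = ⊥-elim (asym ιp≺ιq (chain q p gt))

    ≺-downward : ∀ {p p′ w} → toℕ p ≤ toℕ p′ → ι p′ ≺ w → ι p ≺ w
    ≺-downward {p} {p′} {w} le ιp′≺w with m≤n⇒m<n∨m≡n le
    ... | inj₁ lt = ≺-trans (chain p p′ lt) ιp′≺w
    ... | inj₂ eq = subst (λ t → ι t ≺ w) (sym (toℕ-injective eq)) ιp′≺w

    ≺-upward : ∀ {p p′ w} → toℕ p ≤ toℕ p′ → w ≺ ι p → w ≺ ι p′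
    ≺-upward {p} {p′} {w} le w≺ιp with m≤n⇒m<n∨m≡n le
    ... | inj₁ lt = ≺-trans w≺ιp (chain p p′ lt)
    ... | inj₂ eq = subst (λ t → w ≺ ι t) (toℕ-injective eq) w≺ιp

  module α = Chain inj₁ α-chain
  module β = Chain inj₂ β-chain

  below : ∀ w → InitialSegment (λ q → inj₂ q ≺ w)
  below w = initialSegment (λ q → inj₂ q ≺? w) (λ p q lt → ≺-trans (β-chain p q lt))

  above : ∀ w → FinalSegment (λ q → w ≺ inj₂ q)
  above w = finalSegment (λ q → w ≺? inj₂ q) (λ p q lt w≺p → ≺-trans w≺p (β-chain p q lt))

  below-end≤above-start : ∀ w → InitialSegment.end (below w) ≤ FinalSegment.start (above w)
  below-end≤above-start w = ≮⇒≥ λ lt →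
    let q = fromℕ< (<-≤-trans lt end≤) in
    asym (<⇒member q (subst (_< end) (sym (toℕ-fromℕ< _)) lt))
         (≥⇒member q (≤-reflexive (sym (toℕ-fromℕ< _))))
    where
    open InitialSegment (below w)
    open FinalSegment (above w)

  below-α-mono : ∀ {p p′ : Fin a} → toℕ p ≤ toℕ p′ →
                 InitialSegment.end (below (inj₁ p)) ≤ InitialSegment.end (below (inj₁ p′))
  below-α-mono {p} {p′} p≤p′ = ≮⇒≥ λ lt →
    let q = fromℕ< (<-≤-trans lt ↓p.end≤) in
    <-irrefl (toℕ-fromℕ< _)
      (↓p′.member⇒< q (α.≺-upward p≤p′ (↓p.<⇒member q (subst (_< ↓p.end) (sym (toℕ-fromℕ< _)) lt))))
    where
    module ↓p = InitialSegment (below (inj₁ p))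
    module ↓p′ = InitialSegment (below (inj₁ p′))

  InBox : (la ha lb hb : ℕ) → Pred (Elt a b) 0ℓ
  InBox la ha lb hb (inj₁ p) = la ≤ toℕ p × toℕ p < ha
  InBox la ha lb hb (inj₂ q) = lb ≤ toℕ q × toℕ q < hb

  inBox? : ∀ la ha lb hb → Decidable₁ (InBox la ha lb hb)
  inBox? la ha lb hb (inj₁ p) = (la ≤? toℕ p) ×-dec (toℕ p <? ha)
  inBox? la ha lb hb (inj₂ q) = (lb ≤? toℕ q) ×-dec (toℕ q <? hb)

  count-box : ∀ la ha lb hb → ha ≤ a → hb ≤ b →
              count (inBox? la ha lb hb) (allElt a b) ≡ (ha ∸ la) + (hb ∸ lb)
  count-box la ha lb hb ha≤ hb≤ = trans (count-++ box? (map inj₁ (allFin a)) (map inj₂ (allFin b)))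
    (cong₂ _+_ (trans (count-map box? inj₁ (allFin a)) (count-interval a _ la ha ha≤ λ _ → mk⇔ id id))
               (trans (count-map box? inj₂ (allFin b)) (count-interval b _ lb hb hb≤ λ _ → mk⇔ id id)))
    where
    box? = inBox? la ha lb hb

  module _ {P : Pred (Elt a b) 0ℓ} (P? : Decidable₁ P) (la ha lb hb : ℕ) (ha≤ : ha ≤ a) (hb≤ : hb ≤ b) where

    count≤box : (∀ v → P v → InBox la ha lb hb v) → count P? (allElt a b) ≤ (ha ∸ la) + (hb ∸ lb)
    count≤box P⇒box = subst (count P? (allElt a b) ≤_) (count-box la ha lb hb ha≤ hb≤)
                            (count-mono P? (inBox? la ha lb hb) P⇒box (allElt a b))

    box≤count : (∀ v → InBox la ha lb hb v → P v) → (ha ∸ la) + (hb ∸ lb) ≤ count P? (allElt a b)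
    box≤count box⇒P = subst (_≤ count P? (allElt a b)) (count-box la ha lb hb ha≤ hb≤)
                            (count-mono (inBox? la ha lb hb) P? box⇒P (allElt a b))

  h≡count : ∀ z w → h z w ≡ count (λ v → (z ≺? v) ×-dec (v ≺? w)) (allElt a b)
  h≡count z w = count-filter (z ≺?_) (_≺? w) (allElt a b)

  α-index : ∀ {m} (p : Fin a) → toℕ p ≡ m → α (+ suc m) ≡ el (inj₁ p)
  α-index {m} p p≡m with m <? a
  ... | yes m<a = cong (λ t → el (inj₁ t)) (toℕ-injective (trans (toℕ-fromℕ< m<a) (sym p≡m)))
  ... | no m≮a = ⊥-elim (m≮a (subst (_< a) p≡m (toℕ<n p)))

  β-view : ∀ m → (Σ (m < b) λ m<b → β (+ suc m) ≡ el (inj₂ (fromℕ< m<b)))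
                ⊎ (¬ m < b × β (+ suc m) ≡ top)
  β-view m with m <? b
  ... | yes m<b = inj₁ (m<b , refl)
  ... | no m≮b = inj₂ (m≮b , refl)

  β-nonpositive : ∀ t → β (ℤ.- + t) ≡ bot
  β-nonpositive zero = refl
  β-nonpositive (suc t) = refl

  ¬⊏bot : ∀ X → ¬ (X ⊏ bot)
  ¬⊏bot bot ()
  ¬⊏bot (el _) ()
  ¬⊏bot top ()

  ¬top⊏ : ∀ X → ¬ (top ⊏ X)
  ¬top⊏ bot ()
  ¬top⊏ (el _) ()
  ¬top⊏ top ()

  module _ (w : Elt a b) where
    open InitialSegment (below w)
    open FinalSegment (above w)

    β⊏⇔<end : ∀ m → (β (+ suc m) ⊏ el w) ⇔ (m < end)
    β⊏⇔<end m with β-view m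
    ... | inj₁ (m<b , eq) rewrite eq = mk⇔
      (λ q≺w → subst (_< end) (toℕ-fromℕ< m<b) (member⇒< _ q≺w))
      (λ m<end → <⇒member _ (subst (_< end) (sym (toℕ-fromℕ< m<b)) m<end))
    ... | inj₂ (m≮b , eq) rewrite eq = mk⇔ (λ top⊏w → ⊥-elim (¬top⊏ (el w) top⊏w))
                                           (λ m<end → ⊥-elim (m≮b (<-≤-trans m<end end≤)))

    ⊏β⇔start≤ : ∀ m → (el w ⊏ β (+ suc m)) ⇔ (start ≤ m)
    ⊏β⇔start≤ m with β-view m
    ... | inj₁ (m<b , eq) rewrite eq = mk⇔
      (λ w≺q → subst (start ≤_) (toℕ-fromℕ< m<b) (member⇒≥ _ w≺q))
      (λ start≤m → ≥⇒member _ (subst (start ≤_) (sym (toℕ-fromℕ< m<b)) start≤m))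
    ... | inj₂ (m≮b , eq) rewrite eq = mk⇔ (λ _ → ≤-trans start≤ (≮⇒≥ m≮b)) (λ _ → tt)

    ∥β⇔between : ∀ m → (el w ∥ β (+ suc m)) ⇔ (end ≤ m × m < start)
    ∥β⇔between m = mk⇔
      (λ (w⋢ , ⋢w) → ≮⇒≥ (λ m<end → ⋢w (Equivalence.from (β⊏⇔<end m) m<end))
                   , ≰⇒> (λ start≤m → w⋢ (Equivalence.from (⊏β⇔start≤ m) start≤m)))
      (λ (end≤m , m<start) → (λ w⊏ → <⇒≱ m<start (Equivalence.to (⊏β⇔start≤ m) w⊏))
                           , (λ ⊏w → <⇒≱ (Equivalence.to (β⊏⇔<end m) ⊏w) end≤m))

  β-consecutive : ∀ m → suc m < b → β (+ suc m) ⊏ β (+ suc (m + 1))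
  β-consecutive m m+1<b with β-view m | β-view (m + 1)
  ... | inj₁ (m<b , eq) | inj₁ (m+1<b , eq′) rewrite eq | eq′ =
    β-chain _ _ (subst₂ _<_ (sym (toℕ-fromℕ< m<b)) (sym (toℕ-fromℕ< m+1<b)) (m<m+n m z<s))
  ... | inj₂ (m≮b , _) | _ = ⊥-elim (m≮b (<-trans (n<1+n m) m+1<b))
  ... | _ | inj₂ (m+1≮b , _) = ⊥-elim (m+1≮b (subst (_< b) (+-comm 1 m) m+1<b))

  bot⊏β : ∀ m → bot ⊏ β (+ suc m)
  bot⊏β m with β-view m
  ... | inj₁ (_ , eq) rewrite eq = tt
  ... | inj₂ (_ , eq) rewrite eq = tt

  module Pair (i j : Fin a) (i<j : toℕ i < toℕ j) (e : ℕ) (r+e≤n : (toℕ j ∸ toℕ i) + e ≤ a + b) where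

    I J r k : ℕ
    I = toℕ i
    J = toℕ j
    r = J ∸ I
    k = r + e

    J≡I+r : J ≡ I + r
    J≡I+r = sym (m+[n∸m]≡n (<⇒≤ i<j))

    x y : Elt a b
    x = inj₁ i
    y = inj₁ j

    i⁺ : Fin a
    i⁺ = fromℕ< (≤-<-trans i<j (toℕ<n j))

    i⁺≡ : toℕ i⁺ ≡ suc I
    i⁺≡ = toℕ-fromℕ< _

    x⁺ : Elt a b
    x⁺ = inj₁ i⁺

    module ↓y = InitialSegment (below y)
    module ↑y = FinalSegment (above y)
    module ↓x = InitialSegment (below x)
    module ↑x = FinalSegment (above x)
    module ↓x⁺ = InitialSegment (below x⁺)

    ℓ u ℓx ux ℓ⁺ : ℕ
    ℓ = ↓y.end
    u = ↑y.start
    ℓx = ↓x.end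
    ux = ↑x.start
    ℓ⁺ = ↓x⁺.end

    x≺x⁺ : x ≺ x⁺
    x≺x⁺ = α-chain i i⁺ (subst (I <_) (sym i⁺≡) (n<1+n I))

    i⁺≤J : toℕ i⁺ ≤ J
    i⁺≤J = subst (_≤ J) (sym i⁺≡) i<j

    y⊀x⁺ : ¬ (y ≺ x⁺)
    y⊀x⁺ y≺x⁺ = <⇒≱ (α.reflects y≺x⁺) i⁺≤J

    f-y : f y ≡ J + ℓ
    f-y = ≤-antisym
      (count≤box (_≺? y) 0 J 0 ℓ (<⇒≤ (toℕ<n j)) ↓y.end≤ λ
        { (inj₁ p) p≺y → z≤n , α.reflects p≺y ; (inj₂ q) q≺y → z≤n , ↓y.member⇒< q q≺y })
      (box≤count (_≺? y) 0 J 0 ℓ (<⇒≤ (toℕ<n j)) ↓y.end≤ λ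
        { (inj₁ p) (_ , lt) → α-chain p j lt ; (inj₂ q) (_ , lt) → ↓y.<⇒member q lt })

    g-y : g y ≡ (a ∸ suc J) + (b ∸ u)
    g-y = ≤-antisym
      (count≤box (y ≺?_) (suc J) a u b ≤-refl ≤-refl λ
        { (inj₁ p) y≺p → α.reflects y≺p , toℕ<n p ; (inj₂ q) y≺q → ↑y.member⇒≥ q y≺q , toℕ<n q })
      (box≤count (y ≺?_) (suc J) a u b ≤-refl ≤-refl λ
        { (inj₁ p) (lt , _) → α-chain j p lt ; (inj₂ q) (le , _) → ↑y.≥⇒member q le })

    n∸k<⇔ : ∀ T → (n ∸ k < (suc I + T) + g y) ⇔ (u < T + e)
    n∸k<⇔ T = ⇔-trans (∸<⇔<+ r+e≤n) (<-transpose (begin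
        a + b + (T + e)
          ≡⟨ cong₂ (λ a′ b′ → a′ + b′ + (T + e)) a≡ b≡ ⟩
        (suc (I + r) + A) + (u + B) + (T + e)
          ≡⟨ rearrange I r A u B T e ⟩
        u + ((suc I + T) + (A + B) + (r + e))
          ≡⟨ cong (λ G → u + ((suc I + T) + G + k)) (sym g-y) ⟩
        u + ((suc I + T) + g y + k) ∎))
      where
      open ≡-Reasoning
      A = a ∸ suc J
      B = b ∸ u
      a≡ : a ≡ suc (I + r) + A
      a≡ = trans (sym (m+[n∸m]≡n (toℕ<n j))) (cong (λ t → suc t + A) J≡I+r)
      b≡ : b ≡ u + B
      b≡ = sym (m+[n∸m]≡n ↑y.start≤)
      rearrange : ∀ I r A u B T e →
                  (suc (I + r) + A) + (u + B) + (T + e) ≡ u + ((suc I + T) + (A + B) + (r + e))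
      rearrange = solve-∀

    k<f-y⇔ : (k < f y) ⇔ (e < I + ℓ)
    k<f-y⇔ = subst (λ F → (k < F) ⇔ (e < I + ℓ)) (sym f-y) (<-transpose
      (trans (rearrange r e I ℓ) (cong (λ t → e + (t + ℓ)) (sym J≡I+r))))
      where
      rearrange : ∀ r e I ℓ → r + e + (I + ℓ) ≡ e + (I + r + ℓ)
      rearrange = solve-∀

    k<r+⇔ : ∀ w → (k < r + (ℓ ∸ w)) ⇔ (w + e < ℓ)
    k<r+⇔ w = mk⇔
      (λ lt → let e<ℓ∸w = +-cancelˡ-< r e (ℓ ∸ w) lt in
        subst (_≤ ℓ) (cong suc (+-comm e w))
          (m≤o∸n⇒m+n≤o (suc e) (<⇒≤ (m∸n≢0⇒n<m λ eq → n≮0 (subst (e <_) eq e<ℓ∸w))) e<ℓ∸w))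
      (λ lt → +-monoʳ-< r (m+n≤o⇒m≤o∸n (suc e) (subst (_≤ ℓ) (cong suc (+-comm w e)) lt)))

    predecessor : I ≡ 0 ⊎ Σ (Fin a) λ p → suc (toℕ p) ≡ I
    predecessor with zero⊎suc I
    ... | inj₁ I≡0 = inj₁ I≡0
    ... | inj₂ (I′ , I≡) = inj₂ (fromℕ< I′<a , trans (cong suc (toℕ-fromℕ< I′<a)) (sym I≡))
      where
      I′<a : I′ < a
      I′<a = <-trans (n<1+n I′) (subst (_< a) I≡ (toℕ<n i))

    -- c₀ + 1 is the paper's c − s.
    record Bounds : Set where
      field
        c₀      : ℕ
        ℓ≡      : ℓ ≡ suc (e + c₀)
        pred-above≤c₀ : ∀ p → suc (toℕ p) ≡ I → FinalSegment.start (above (inj₁ p)) ≤ c₀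
        u<ℓ⁺+e  : u < ℓ⁺ + e
        ℓx+e<ℓ  : ℓx + e < ℓ
        u<ux+e  : u < ux + e

    module FromMidway (mid : Midway x y k) where

      midway₁ : ∀ z → x ≺ z → ¬ (y ≺ z) → n ∸ k < f z + g y
      midway₁ = proj₁ mid
      midway₂ : ∀ z → z ≺ x → k < h z y
      midway₂ = proj₁ (proj₂ mid)
      midway₃ : k < f y
      midway₃ = proj₂ (proj₂ mid)

      midway₂⇒+e<ℓ : ∀ z → z ≺ x → ∀ w → (∀ v → z ≺ v → v ≺ y → InBox I J w ℓ v) → w + e < ℓ
      midway₂⇒+e<ℓ z z≺x w in-box = Equivalence.to (k<r+⇔ w) (<-≤-trans (midway₂ z z≺x)
        (subst (_≤ r + (ℓ ∸ w)) (sym (h≡count z y))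
          (count≤box _ I J w ℓ (<⇒≤ (toℕ<n j)) ↓y.end≤ λ v (z≺v , v≺y) → in-box v z≺v v≺y)))

      above-predecessor : ∀ p → suc (toℕ p) ≡ I → FinalSegment.start (above (inj₁ p)) + e < ℓ
      above-predecessor p p+1≡I = midway₂⇒+e<ℓ (inj₁ p) p≺x ↑p.start λ
        { (inj₁ p′) p≺p′ p′≺y → subst (_≤ toℕ p′) p+1≡I (α.reflects p≺p′) , α.reflects p′≺y
        ; (inj₂ q) p≺q q≺y → ↑p.member⇒≥ q p≺q , ↓y.member⇒< q q≺y }
        where
        module ↑p = FinalSegment (above (inj₁ p))
        p≺x : inj₁ p ≺ x
        p≺x = α-chain p i (subst (toℕ p <_) p+1≡I (n<1+n _))

      e<ℓ : e < ℓ
      e<ℓ with predecessor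
      ... | inj₁ I≡0 = subst (λ t → e < t + ℓ) I≡0 (Equivalence.to k<f-y⇔ midway₃)
      ... | inj₂ (p , p+1≡I) = ≤-<-trans (m≤n+m e _) (above-predecessor p p+1≡I)

      c₀ : ℕ
      c₀ = ℓ ∸ suc e

      ℓ≡ : ℓ ≡ suc (e + c₀)
      ℓ≡ = sym (m+[n∸m]≡n e<ℓ)

      pred-above≤c₀ : ∀ p → suc (toℕ p) ≡ I → FinalSegment.start (above (inj₁ p)) ≤ c₀
      pred-above≤c₀ p p+1≡I = +-cancelʳ-≤ e start c₀ (subst (start + e ≤_) (+-comm e c₀)
        (s≤s⁻¹ (subst (start + e <_) ℓ≡ (above-predecessor p p+1≡I))))
        where
        start = FinalSegment.start (above (inj₁ p))

      f-x⁺≤ : f x⁺ ≤ suc I + ℓ⁺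
      f-x⁺≤ = count≤box (_≺? x⁺) 0 (suc I) 0 ℓ⁺ (toℕ<n i) ↓x⁺.end≤ λ
        { (inj₁ p) p≺x⁺ → z≤n , subst (toℕ p <_) i⁺≡ (α.reflects p≺x⁺)
        ; (inj₂ q) q≺x⁺ → z≤n , ↓x⁺.member⇒< q q≺x⁺ }

      u<ℓ⁺+e : u < ℓ⁺ + e
      u<ℓ⁺+e = Equivalence.to (n∸k<⇔ ℓ⁺)
        (<-≤-trans (midway₁ x⁺ x≺x⁺ y⊀x⁺) (+-monoˡ-≤ (g y) f-x⁺≤))

      module LastBelowX (L : ℕ) (ℓx≡ : ℓx ≡ suc L) where

        L<b : L < b
        L<b = subst (_≤ b) ℓx≡ ↓x.end≤

        last : Elt a b
        last = inj₂ (fromℕ< L<b)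

        last-index : toℕ (fromℕ< L<b) ≡ L
        last-index = toℕ-fromℕ< L<b

        last≺x : last ≺ x
        last≺x = ↓x.<⇒member _ (subst₂ _<_ (sym last-index) (sym ℓx≡) (n<1+n L))

        α-above-last-≥I⇒ : (∀ p → last ≺ inj₁ p → I ≤ toℕ p) → ℓx + e < ℓ
        α-above-last-≥I⇒ α-above-last = midway₂⇒+e<ℓ last last≺x ℓx λ
          { (inj₁ p) last≺p p≺y → α-above-last p last≺p , α.reflects p≺y
          ; (inj₂ q) last≺q q≺y →
              subst₂ _≤_ (sym ℓx≡) refl (subst (_< toℕ q) last-index (β.reflects last≺q)) , ↓y.member⇒< q q≺y }

        ℓx+e<ℓ : ℓx + e < ℓ
        ℓx+e<ℓ with predecessor
        ... | inj₁ I≡0 = α-above-last-≥I⇒ λ p _ → subst (_≤ toℕ p) (sym I≡0) z≤n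
        ... | inj₂ (p₀ , p₀+1≡I) with last ≺? inj₁ p₀
        ...   | yes last≺p₀ = ≤-<-trans (+-monoˡ-≤ e ℓx≤start) (above-predecessor p₀ p₀+1≡I)
          where
          module ↑p₀ = FinalSegment (above (inj₁ p₀))
          ℓx≤start : ℓx ≤ ↑p₀.start
          ℓx≤start = subst (_≤ ↑p₀.start) (sym ℓx≡) (≰⇒> λ start≤L →
            asym last≺p₀ (↑p₀.≥⇒member _ (subst (↑p₀.start ≤_) (sym last-index) start≤L)))
        ...   | no last⊀p₀ = α-above-last-≥I⇒ λ p last≺p → subst (_≤ toℕ p) p₀+1≡I (≰⇒> λ p≤p₀ →
                  last⊀p₀ (α.≺-upward p≤p₀ last≺p))

      ℓx+e<ℓ : ℓx + e < ℓ
      ℓx+e<ℓ with zero⊎suc ℓx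
      ... | inj₁ ℓx≡0 = subst (λ t → t + e < ℓ) (sym ℓx≡0) e<ℓ
      ... | inj₂ (L , ℓx≡) = LastBelowX.ℓx+e<ℓ L ℓx≡


      module FirstAboveX (ux<u : ux < u) where

        ux<b : ux < b
        ux<b = <-≤-trans ux<u ↑y.start≤

        first : Elt a b
        first = inj₂ (fromℕ< ux<b)

        first-index : toℕ (fromℕ< ux<b) ≡ ux
        first-index = toℕ-fromℕ< ux<b

        x≺first : x ≺ first
        x≺first = ↑x.≥⇒member _ (≤-reflexive (sym first-index))

        y⊀first : ¬ (y ≺ first)
        y⊀first y≺first = <⇒≱ ux<u (subst (u ≤_) first-index (↑y.member⇒≥ _ y≺first))

        u<ux+e : u < ux + e
        u<ux+e with x⁺ ≺? first
        ... | yes x⁺≺first = <-≤-trans u<ℓ⁺+e (+-monoˡ-≤ e (≮⇒≥ λ ux<ℓ⁺ →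
                asym x⁺≺first (↓x⁺.<⇒member _ (subst (_< ℓ⁺) (sym first-index) ux<ℓ⁺))))
        ... | no x⁺⊀first = Equivalence.to (n∸k<⇔ ux)
                (<-≤-trans (midway₁ first x≺first y⊀first) (+-monoˡ-≤ (g y) f-first≤))
          where
          f-first≤ : f first ≤ suc I + ux
          f-first≤ = count≤box (_≺? first) 0 (suc I) 0 ux (toℕ<n i) ↑x.start≤ λ
            { (inj₁ p) p≺first → z≤n , ≰⇒> λ I+1≤p →
                x⁺⊀first (α.≺-downward (subst (_≤ toℕ p) (sym i⁺≡) I+1≤p) p≺first)
            ; (inj₂ q) q≺first → z≤n , subst (toℕ q <_) first-index (β.reflects q≺first) }

      u<ux+e : u < ux + e
      u<ux+e with ux <? u
      ... | yes ux<u = FirstAboveX.u<ux+e ux<u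
      ... | no ux≮u = <-≤-trans u<ℓ⁺+e (+-monoˡ-≤ e ℓ⁺≤ux)
        where
        ℓ⁺≤ux : ℓ⁺ ≤ ux
        ℓ⁺≤ux = ≤-trans (below-α-mono i⁺≤J) (≤-trans (below-end≤above-start y) (≮⇒≥ ux≮u))

      bounds : Bounds
      bounds = record
        { c₀ = c₀ ; ℓ≡ = ℓ≡ ; pred-above≤c₀ = pred-above≤c₀
        ; u<ℓ⁺+e = u<ℓ⁺+e ; ℓx+e<ℓ = ℓx+e<ℓ ; u<ux+e = u<ux+e }

    module FromBounds (B : Bounds) where
      open Bounds B

      e<ℓ : e < ℓ
      e<ℓ = subst (e <_) (sym ℓ≡) (s≤s (m≤m+n e c₀))

      midway₁ : ∀ z → x ≺ z → ¬ (y ≺ z) → n ∸ k < f z + g y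
      midway₁ (inj₁ p) x≺p _ = <-≤-trans (Equivalence.from (n∸k<⇔ ℓ⁺) u<ℓ⁺+e) (+-monoˡ-≤ (g y) f-p≥)
        where
        f-p≥ : suc I + ℓ⁺ ≤ f (inj₁ p)
        f-p≥ = box≤count (_≺? inj₁ p) 0 (suc I) 0 ℓ⁺ (toℕ<n i) ↓x⁺.end≤ λ
          { (inj₁ p′) (_ , lt) → α-chain p′ p (≤-<-trans (s≤s⁻¹ lt) (α.reflects x≺p))
          ; (inj₂ q) (_ , lt) →
              α.≺-upward (subst (_≤ toℕ p) (sym i⁺≡) (α.reflects x≺p)) (↓x⁺.<⇒member q lt) }
      midway₁ (inj₂ q) x≺q _ =
        <-≤-trans (Equivalence.from (n∸k<⇔ (toℕ q))
                    (<-≤-trans u<ux+e (+-monoˡ-≤ e (↑x.member⇒≥ q x≺q))))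
                  (+-monoˡ-≤ (g y) f-q≥)
        where
        f-q≥ : suc I + toℕ q ≤ f (inj₂ q)
        f-q≥ = box≤count (_≺? inj₂ q) 0 (suc I) 0 (toℕ q) (toℕ<n i) (<⇒≤ (toℕ<n q)) λ
          { (inj₁ p′) (_ , lt) → α.≺-downward (s≤s⁻¹ lt) x≺q
          ; (inj₂ q′) (_ , lt) → β-chain q′ q lt }

      +e<ℓ⇒midway₂ : ∀ z w → (∀ v → InBox I J w ℓ v → z ≺ v) → w + e < ℓ → k < h z y
      +e<ℓ⇒midway₂ z w box⇒above w+e<ℓ = <-≤-trans (Equivalence.from (k<r+⇔ w) w+e<ℓ)
        (subst (r + (ℓ ∸ w) ≤_) (sym (h≡count z y))
          (box≤count _ I J w ℓ (<⇒≤ (toℕ<n j)) ↓y.end≤ λ v v∈box →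
             box⇒above v v∈box , below-y v v∈box))
        where
        below-y : ∀ v → InBox I J w ℓ v → v ≺ y
        below-y (inj₁ p) (_ , lt) = α-chain p j lt
        below-y (inj₂ q) (_ , lt) = ↓y.<⇒member q lt

      midway₂ : ∀ z → z ≺ x → k < h z y
      midway₂ (inj₁ p) p≺x =
        +e<ℓ⇒midway₂ (inj₁ p) c₀ above-p (subst (c₀ + e <_) (sym ℓ≡) (s≤s (≤-reflexive (+-comm c₀ e))))
        where
        above-p : ∀ v → InBox I J c₀ ℓ v → inj₁ p ≺ v
        above-p (inj₁ p′) (I≤p′ , _) = α-chain p p′ (<-≤-trans (α.reflects p≺x) I≤p′)
        above-p (inj₂ q) (c₀≤q , _) with predecessor
        ... | inj₁ I≡0 = ⊥-elim (n≮0 (subst (toℕ p <_) I≡0 (α.reflects p≺x)))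
        ... | inj₂ (p₀ , p₀+1≡I) =
          α.≺-downward (s≤s⁻¹ (subst (toℕ p <_) (sym p₀+1≡I) (α.reflects p≺x)))
                       (FinalSegment.≥⇒member (above (inj₁ p₀)) q (≤-trans (pred-above≤c₀ p₀ p₀+1≡I) c₀≤q))
      midway₂ (inj₂ q) q≺x = +e<ℓ⇒midway₂ (inj₂ q) ℓx above-q ℓx+e<ℓ
        where
        above-q : ∀ v → InBox I J ℓx ℓ v → inj₂ q ≺ v
        above-q (inj₁ p′) (I≤p′ , _) = α.≺-upward I≤p′ q≺x
        above-q (inj₂ q′) (ℓx≤q′ , _) = β-chain q q′ (<-≤-trans (↓x.member⇒< q q≺x) ℓx≤q′)

      midway₃ : k < f y
      midway₃ = Equivalence.from k<f-y⇔ (<-≤-trans e<ℓ (m≤n+m ℓ I))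

      midway : Midway x y k
      midway = midway₁ , midway₂ , midway₃

    midway⇔bounds : Midway x y k ⇔ Bounds
    midway⇔bounds = mk⇔ FromMidway.bounds FromBounds.midway

    s : ℤ
    s = + suc I

    ConditionsAt : ℕ → ℕ → Set
    ConditionsAt c d = Conditions s (+ r) (+ k) (+ c) (+ d)

    ∃Conditions : Set
    ∃Conditions = Σ ℕ λ c → Σ ℕ λ d → 1 < c × c < d × d ≤ a + b × ConditionsAt c d

    s-1≡ : s ℤ.- + 1 ≡ + I
    s-1≡ = cancel (+ 1) (+ I)
      where
      cancel : ∀ (O X : ℤ) → O ℤ.+ X ℤ.- O ≡ X
      cancel = ℤ-Solver.solve-∀

    c-s≡ : ∀ P → + (suc I + suc P) ℤ.- s ≡ + suc P
    c-s≡ P = cancel s (+ suc P)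
      where
      cancel : ∀ (O X : ℤ) → O ℤ.+ X ℤ.- O ≡ X
      cancel = ℤ-Solver.solve-∀

    c+k-r-s≡ : ∀ P → + (suc I + suc P) ℤ.+ + k ℤ.- + r ℤ.- s ≡ + suc (P + e)
    c+k-r-s≡ P = cancel s (+ suc P) (+ r) (+ e)
      where
      cancel : ∀ (S Y R E : ℤ) → S ℤ.+ Y ℤ.+ (R ℤ.+ E) ℤ.- R ℤ.- S ≡ Y ℤ.+ E
      cancel = ℤ-Solver.solve-∀

    c+[k-r-s]+1≡ : ∀ P → + (suc I + suc P) ℤ.+ (+ k ℤ.- + r ℤ.- s) ℤ.+ + 1 ≡ + suc (suc (P + e))
    c+[k-r-s]+1≡ P = trans (cancel s (+ suc P) (+ r) (+ e)) (cong +_ (+-comm (suc (P + e)) 1))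
      where
      cancel : ∀ (S Y R E : ℤ) → S ℤ.+ Y ℤ.+ (R ℤ.+ E ℤ.- R ℤ.- S) ℤ.+ + 1 ≡ Y ℤ.+ E ℤ.+ + 1
      cancel = ℤ-Solver.solve-∀

    d+[k-r-s]-1≡ : ∀ Q → + (suc I + suc Q) ℤ.+ (+ k ℤ.- + r ℤ.- s) ℤ.- + 1 ≡ + (Q + e)
    d+[k-r-s]-1≡ Q = cancel s (+ Q) (+ r) (+ e)
      where
      cancel : ∀ (S Q R E : ℤ) → S ℤ.+ (+ 1 ℤ.+ Q) ℤ.+ (R ℤ.+ E ℤ.- R ℤ.- S) ℤ.- + 1 ≡ Q ℤ.+ E
      cancel = ℤ-Solver.solve-∀

    αs≡x : α s ≡ el x
    αs≡x = α-index i refl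

    αs+r≡y : α (s ℤ.+ + r) ≡ el y
    αs+r≡y = α-index j J≡I+r

    αs+1≡x⁺ : α (s ℤ.+ + 1) ≡ el x⁺
    αs+1≡x⁺ = α-index i⁺ (trans i⁺≡ (+-comm 1 I))

    αs-1≡pred : ∀ p → suc (toℕ p) ≡ I → α (s ℤ.- + 1) ≡ el (inj₁ p)
    αs-1≡pred p p+1≡I = trans (cong α (trans s-1≡ (cong +_ (sym p+1≡I)))) (α-index p refl)

    +≤⇒+ : ∀ {m} z → + m ℤ.≤ z → Σ ℕ λ m′ → z ≡ + m′ × m ≤ m′
    +≤⇒+ (+ m′) (ℤ.+≤+ m≤m′) = m′ , refl , m≤m′

    module FromConditions (P Q : ℕ) (P≤Q : P ≤ Q) (cond : ConditionsAt (suc I + suc P) (suc I + suc Q)) where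

      pred⊏βP = proj₁ (proj₁ cond)
      βQ⊏x⁺   = proj₂ (proj₂ (proj₁ cond))
      β⊏y     = proj₁ (proj₁ (proj₂ cond))
      y⊏β     = proj₂ (proj₁ (proj₂ cond))
      x∥β     = proj₁ (proj₂ (proj₂ cond))

      P+e<ℓ : P + e < ℓ
      P+e<ℓ = Equivalence.to (β⊏⇔<end y (P + e)) (subst₂ _⊏_ (cong β (c+k-r-s≡ P)) αs+r≡y β⊏y)

      Q<ℓ⁺ : Q < ℓ⁺
      Q<ℓ⁺ = Equivalence.to (β⊏⇔<end x⁺ Q) (subst₂ _⊏_ (cong β (c-s≡ Q)) αs+1≡x⁺ βQ⊏x⁺)

      u≤Q+e : u ≤ Q + e
      u≤Q+e = Equivalence.to (⊏β⇔start≤ y (Q + e)) (subst₂ _⊏_ αs+r≡y (cong β (c+k-r-s≡ Q)) y⊏β)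

      between-x : ∀ m → P ≤ m → m ≤ Q → ℓx ≤ m × m < ux
      between-x m P≤m m≤Q = Equivalence.to (∥β⇔between x m) (subst₂ _∥_ αs≡x refl
        (x∥β (+ suc m) (subst (ℤ._≤ + suc m) (sym (c-s≡ P)) (ℤ.+≤+ (s≤s P≤m)))
                       (subst (+ suc m ℤ.≤_) (sym (c-s≡ Q)) (ℤ.+≤+ (s≤s m≤Q)))))

      e<ℓ : e < ℓ
      e<ℓ = ≤-<-trans (m≤n+m e P) P+e<ℓ

      c₀ : ℕ
      c₀ = ℓ ∸ suc e

      ℓ≡ : ℓ ≡ suc (e + c₀)
      ℓ≡ = sym (m+[n∸m]≡n e<ℓ)

      P≤c₀ : P ≤ c₀
      P≤c₀ = +-cancelʳ-≤ e P c₀ (subst (P + e ≤_) (+-comm e c₀) (s≤s⁻¹ (subst (P + e <_) ℓ≡ P+e<ℓ)))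

      bounds : Bounds
      bounds = record
        { c₀ = c₀
        ; ℓ≡ = ℓ≡
        ; pred-above≤c₀ = λ p p+1≡I → ≤-trans (Equivalence.to (⊏β⇔start≤ (inj₁ p) P)
                            (subst₂ _⊏_ (αs-1≡pred p p+1≡I) (cong β (c-s≡ P)) pred⊏βP)) P≤c₀
        ; u<ℓ⁺+e = ≤-<-trans u≤Q+e (+-monoˡ-< e Q<ℓ⁺)
        ; ℓx+e<ℓ = ≤-<-trans (+-monoˡ-≤ e (proj₁ (between-x P ≤-refl P≤Q))) P+e<ℓ
        ; u<ux+e = ≤-<-trans u≤Q+e (+-monoˡ-< e (proj₂ (between-x Q P≤Q ≤-refl)))
        }

    module ToConditions (B : Bounds) where
      open Bounds B

      P Q c d : ℕ
      P = c₀
      Q = u ∸ e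
      c = suc I + suc P
      d = suc I + suc Q

      ℓ≡P+e+1 : ℓ ≡ suc (P + e)
      ℓ≡P+e+1 = trans ℓ≡ (cong suc (+-comm e P))

      u≡Q+e : u ≡ Q + e
      u≡Q+e = trans (sym (m+[n∸m]≡n e≤u)) (+-comm e Q)
        where
        e≤u : e ≤ u
        e≤u = ≤-trans (<⇒≤ (subst (e <_) (sym ℓ≡) (s≤s (m≤m+n e c₀)))) (below-end≤above-start y)

      P<Q : P < Q
      P<Q = +-cancelʳ-≤ e (suc P) Q (subst₂ _≤_ ℓ≡P+e+1 u≡Q+e (below-end≤above-start y))

      Q<ℓ⁺ : Q < ℓ⁺
      Q<ℓ⁺ = +-cancelʳ-< e Q ℓ⁺ (subst (_< ℓ⁺ + e) u≡Q+e u<ℓ⁺+e)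

      Q<ux : Q < ux
      Q<ux = +-cancelʳ-< e Q ux (subst (_< ux + e) u≡Q+e u<ux+e)

      ℓx≤P : ℓx ≤ P
      ℓx≤P = +-cancelʳ-≤ e ℓx P (s≤s⁻¹ (subst (ℓx + e <_) ℓ≡P+e+1 ℓx+e<ℓ))

      pred⊏βP : α (s ℤ.- + 1) ⊏ β (+ c ℤ.- s)
      pred⊏βP with predecessor
      ... | inj₁ I≡0 =
        subst₂ _⊏_ (sym (cong α (trans s-1≡ (cong +_ I≡0)))) (cong β (sym (c-s≡ P))) (bot⊏β P)
      ... | inj₂ (p , p+1≡I) = subst₂ _⊏_ (sym (αs-1≡pred p p+1≡I)) (cong β (sym (c-s≡ P)))
                                 (Equivalence.from (⊏β⇔start≤ (inj₁ p) P) (pred-above≤c₀ p p+1≡I))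

      β-chain-segment : ∀ z → + c ℤ.- s ℤ.≤ z → z ℤ.< + d ℤ.- s → β z ⊏ β (z ℤ.+ + 1)
      β-chain-segment z c-s≤z z<d-s with +≤⇒+ z (subst (ℤ._≤ z) (c-s≡ P) c-s≤z)
      ... | suc m , refl , _ = β-consecutive m (<-≤-trans (drop‿+<+ (subst (+ suc m ℤ.<_) (c-s≡ Q) z<d-s))
                                                        (<-≤-trans Q<ℓ⁺ ↓x⁺.end≤))

      βQ⊏x⁺ : β (+ d ℤ.- s) ⊏ α (s ℤ.+ + 1)
      βQ⊏x⁺ = subst₂ _⊏_ (cong β (sym (c-s≡ Q))) (sym αs+1≡x⁺)
                (Equivalence.from (β⊏⇔<end x⁺ Q) Q<ℓ⁺)

      β⊏y : β (+ c ℤ.+ + k ℤ.- + r ℤ.- s) ⊏ α (s ℤ.+ + r)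
      β⊏y = subst₂ _⊏_ (cong β (sym (c+k-r-s≡ P))) (sym αs+r≡y)
              (Equivalence.from (β⊏⇔<end y (P + e)) (subst (P + e <_) (sym ℓ≡P+e+1) (n<1+n _)))

      y⊏β : α (s ℤ.+ + r) ⊏ β (+ d ℤ.+ + k ℤ.- + r ℤ.- s)
      y⊏β = subst₂ _⊏_ (sym αs+r≡y) (cong β (sym (c+k-r-s≡ Q)))
              (Equivalence.from (⊏β⇔start≤ y (Q + e)) (≤-reflexive u≡Q+e))

      x∥β : ∀ z → + c ℤ.- s ℤ.≤ z → z ℤ.≤ + d ℤ.- s → α s ∥ β z
      x∥β z c-s≤z z≤d-s with +≤⇒+ z (subst (ℤ._≤ z) (c-s≡ P) c-s≤z)
      ... | suc m , refl , s≤s P≤m = subst₂ _∥_ (sym αs≡x) refl (Equivalence.from (∥β⇔between x m)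
              (≤-trans ℓx≤P P≤m , ≤-<-trans (s≤s⁻¹ (drop‿+≤+ (subst (+ suc m ℤ.≤_) (c-s≡ Q) z≤d-s))) Q<ux))

      y∥β : ∀ z → + c ℤ.+ (+ k ℤ.- + r ℤ.- s) ℤ.+ + 1 ℤ.≤ z → z ℤ.≤ + d ℤ.+ (+ k ℤ.- + r ℤ.- s) ℤ.- + 1 →
            α (s ℤ.+ + r) ∥ β z
      y∥β z lo≤z z≤hi with +≤⇒+ z (subst (ℤ._≤ z) (c+[k-r-s]+1≡ P) lo≤z)
      ... | suc m , refl , s≤s P+e+1≤m = subst₂ _∥_ (sym αs+r≡y) refl (Equivalence.from (∥β⇔between y m)
              (subst (_≤ m) (sym ℓ≡P+e+1) P+e+1≤m
              , subst (m <_) (sym u≡Q+e) (drop‿+≤+ (subst (+ suc m ℤ.≤_) (d+[k-r-s]-1≡ Q) z≤hi))))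

      conditions : ∃Conditions
      conditions = c , d , s≤s (≤-trans (s≤s z≤n) (m≤n+m (suc P) I)) , +-monoʳ-< (suc I) (s≤s P<Q)
                 , +-mono-≤ (toℕ<n i) (<-≤-trans Q<ℓ⁺ ↓x⁺.end≤)
                 , ((pred⊏βP , β-chain-segment , βQ⊏x⁺) , (β⊏y , y⊏β) , x∥β , y∥β)

    conditions⇒bounds : ∃Conditions → Bounds
    conditions⇒bounds (c , d , _ , c<d , _ , cond) with suc I <? c
    ... | no c≯s = ⊥-elim (¬⊏bot (α (s ℤ.- + 1))
                     (subst (α (s ℤ.- + 1) ⊏_) (trans (cong β c-s≡-t) (β-nonpositive t)) (proj₁ (proj₁ cond))))
      where
      t = suc I ∸ c
      c-s≡-t : + c ℤ.- s ≡ ℤ.- + t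
      c-s≡-t = trans (cong (λ v → + c ℤ.- + v) (sym (m+[n∸m]≡n (≮⇒≥ c≯s)))) (cancel (+ c) (+ t))
        where
        cancel : ∀ (C T : ℤ) → C ℤ.- (C ℤ.+ T) ≡ ℤ.- T
        cancel = ℤ-Solver.solve-∀
    ... | yes s<c = FromConditions.bounds P Q P≤Q (subst₂ ConditionsAt c≡ d≡ cond)
      where
      P = c ∸ suc (suc I)
      Q = d ∸ suc (suc I)
      c≡ : c ≡ suc I + suc P
      c≡ = trans (sym (m+[n∸m]≡n s<c)) (sym (+-suc (suc I) P))
      d≡ : d ≡ suc I + suc Q
      d≡ = trans (sym (m+[n∸m]≡n (<-trans s<c c<d))) (sym (+-suc (suc I) Q))
      P≤Q : P ≤ Q
      P≤Q = s≤s⁻¹ (<⇒≤ (+-cancelˡ-< (suc I) (suc P) (suc Q) (subst₂ _<_ c≡ d≡ c<d)))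

    midway⇔conditions : Midway x y k ⇔ ∃Conditions
    midway⇔conditions = ⇔-trans midway⇔bounds (mk⇔ ToConditions.conditions conditions⇒bounds)

strictMono-gap : ∀ {N} (φ : Fin N → ℕ) → (∀ p q → p Fin.< q → φ p < φ q) →
                 ∀ d (p q : Fin N) → toℕ p + d ≡ toℕ q → φ p + d ≤ φ q
strictMono-gap φ mono zero p q p+0≡q =
  subst (λ t → φ p + 0 ≤ φ t) (toℕ-injective (trans (sym (+-identityʳ (toℕ p))) p+0≡q))
        (≤-reflexive (+-identityʳ _))
strictMono-gap {N} φ mono (suc d) p q p+d+1≡q = begin
  φ p + suc d  ≡⟨ +-suc (φ p) d ⟩
  suc (φ p + d) ≤⟨ s≤s (strictMono-gap φ mono d p q′ (sym (toℕ-fromℕ< p+d<N))) ⟩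
  suc (φ q′)    ≤⟨ mono q′ q (subst₂ _<_ (sym (toℕ-fromℕ< p+d<N)) q≡ (n<1+n _)) ⟩
  φ q           ∎
  where
  open ≤-Reasoning
  q≡ : suc (toℕ p + d) ≡ toℕ q
  q≡ = trans (sym (+-suc (toℕ p) d)) p+d+1≡q
  p+d<N : toℕ p + d < N
  p+d<N = <-trans (n<1+n _) (subst (_< N) (sym q≡) (toℕ<n q))
  q′ : Fin N
  q′ = fromℕ< p+d<N

proposition8p11 :
  (a b : ℕ) (_≺_ : Rel (Elt a b) 0ℓ) (_≺?_ : Decidable _≺_)
  → IsStrictPartialOrder _≡_ _≺_
  → (∀ (p q : Fin a) → p Fin.< q → inj₁ p ≺ inj₁ q)
  → (∀ (p q : Fin b) → p Fin.< q → inj₂ p ≺ inj₂ q)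
  → (Σ (Elt a b) λ u → Σ (Elt a b) λ v → ¬ (u ≺ v) × ¬ (v ≺ u) × ¬ (u ≡ v))
  → (i j : Fin a) → i Fin.< j
  → (k : ℕ) → 2 ≤ k → k + 2 ≤ a + b
  → (Σ (Elt a b → Fin (a + b)) λ L → WidthTwo.IsLinExt _≺_ _≺?_ L
       × toℕ (L (inj₁ j)) ≡ toℕ (L (inj₁ i)) + k)
  → WidthTwo.Midway _≺_ _≺?_ (inj₁ i) (inj₁ j) k
    ⇔ (Σ ℕ λ c → Σ ℕ λ d → 1 < c × c < d × d ≤ a + b
         × WidthTwo.Conditions _≺_ _≺?_
             (+ suc (toℕ i)) (+ (toℕ j ∸ toℕ i)) (+ k) (+ c) (+ d))
proposition8p11 a b _≺_ _≺?_ spo α-chain β-chain _ i j i<j k _ k+2≤n (L , linExt , Lj≡Li+k) =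
  subst Characterisation (sym k≡r+e) (Pair.midway⇔conditions i j i<j e (subst (_≤ a + b) k≡r+e k≤n))
  where
  open ChainPartition a b _≺_ _≺?_ spo α-chain β-chain
  open WidthTwo _≺_ _≺?_
  r = toℕ j ∸ toℕ i
  Characterisation : ℕ → Set
  Characterisation k′ = Midway (inj₁ i) (inj₁ j) k′
    ⇔ (Σ ℕ λ c → Σ ℕ λ d → 1 < c × c < d × d ≤ a + b × Conditions (+ suc (toℕ i)) (+ r) (+ k′) (+ c) (+ d))
  r≤k : r ≤ k
  r≤k = +-cancelˡ-≤ (toℕ (L (inj₁ i))) r k (subst (toℕ (L (inj₁ i)) + r ≤_) Lj≡Li+k
          (strictMono-gap (λ p → toℕ (L (inj₁ p))) (λ p q p<q → proj₂ linExt (α-chain p q p<q))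
                          r i j (m+[n∸m]≡n (<⇒≤ i<j))))
  e = k ∸ r
  k≡r+e : k ≡ r + e
  k≡r+e = sym (m+[n∸m]≡n r≤k)
  k≤n : k ≤ a + b
  k≤n = ≤-trans (m≤m+n k 2) k+2≤n
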